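{- Let $G=(V,E)$ be a directed graph with $n$ vertices, $k\ge 7$ a fixed integer, let $\mathcal{C}$ and $G_3$ be constructed from $G$ as described in the context, let $\mathcal{I}$ be the set of isolated $2$-cycles, and let $\mathcal{Q}^*$ be a $k$-path partition of $G$ with the minimum number of paths. Then $$|E(\mathcal{Q}^*)| \le \min\left\{|E(\mathcal{C})| - |\mathcal{I}|,\ \frac{k-1}{k}\,(n-2|\mathcal{I}|) + |\mathcal{I}|\right\},$$ where $E(\mathcal{Q}^*)$ denotes the set of edges on the paths of $\mathcal{Q}^*$.
   Context: Graphs are directed without self-loops or multiple edges. A path is a simple directed path (a single vertex is a path); its order is its number of vertices. A $k$-path partition of $G$ is a collection of vertex-disjoint paths of $G$, each of order at most $k$, covering all vertices; its size is its number of paths. A path-cycle cover of a directed graph $H$ is a spanning subgraph of $H$ in which every vertex has in-degree at most $1$ and out-degree at most $1$; a maximum path-cycle cover is one with the maximum number of edges. $d^+_{\mathcal{C}}(v)$, $d^-_{\mathcal{C}}(v)$ denote out- and in-degree in $\mathcal{C}$. Construction: (i) compute a maximum path-cycle cover $\mathcal{C}$ of $G$; (ii) while there is an edge $(u,v)\in E(G)\setminus E(\mathcal{C})$ such that $d^+_{\mathcal{C}}(u)=0$ and $v$ lies on a cycle of $\mathcal{C}$ (respectively, $d^-_{\mathcal{C}}(v)=0$ and $u$ lies on a cycle of $\mathcal{C}$), replace the edge of $\mathcal{C}$ entering $v$ (respectively, leaving $u$) by $(u,v)$; call the result $\mathcal{C}$. A $2$-cycle is a cycle component of $\mathcal{C}$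 with two vertices. (iii) $G_1=(V,E_1)$ where $E_1$ is the set of edges $(u,v)\in E(G)\setminus E(\mathcal{C})$ with $u,v$ in different components of $\mathcal{C}$, at least one of which is a $2$-cycle. A subgraph $S$ of $G_1$ saturates a $2$-cycle $D$ of $\mathcal{C}$ if some edge of $S$ is incident to a vertex of $D$; the weight of $S$ is the number of $2$-cycles of $\mathcal{C}$ it saturates. (iv) Let $M$ be a maximum-weight path-cycle cover of $G_1$; while some edge $e$ of $M$ can be removed without changing the weight of $M$, delete $e$ from $M$. (v) $G_2=(V,E(\mathcal{C})\cup E(M))$. (vi) $G_3$ is the undirected graph whose vertices correspond one-to-one to the connected components of $\mathcal{C}$, two vertices being adjacent iff there is an edge of $G_2$ between the corresponding components. An isolated $2$-cycle is a $2$-cycle of $\mathcal{C}$ whose corresponding vertex in $G_3$ has degree $0$. -}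

module Defs where

open import Data.Nat using (ℕ; zero; suc; _+_; _*_; _∸_; _≤_; _<ᵇ_)
open import Data.Bool using (Bool; true; false; _∧_; _∨_; not; if_then_else_)
open import Data.Fin using (Fin; toℕ; _≟_)
open import Data.Maybe using (Maybe; just; nothing; is-just)
open import Data.List using (List; []; _∷_; length; filterᵇ; map; concat)
open import Data.Bool.ListAction using (any)
open import Data.Nat.ListAction using (sum)
open import Data.List.Relation.Unary.All using (All)
open import Data.List.Relation.Unary.Linked using (Linked)
open import Data.List.Relation.Unary.Unique.Propositional using (Unique)
open import Data.List.Membership.Propositional using (_∈_)
open import Data.List.Relation.Binary.Permutation.Propositional using (_↭_)
open import Data.Fin.Base using () renaming (_≤_ to _≤ᶠ_)
open import Data.List using (allFin)
open import Data.Product using (Σ; ∃; _×_; _,_)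
open import Data.Sum using (_⊎_)
open import Data.Empty using (⊥)
open import Relation.Nullary using (¬_)
open import Relation.Nullary.Decidable using (⌊_⌋)
open import Relation.Binary.PropositionalEquality using (_≡_)
open import Relation.Binary.Construct.Closure.ReflexiveTransitive using (Star)
open import Function using (_⇔_)

record Digraph (n : ℕ) : Set where
  field
    adj    : Fin n → Fin n → Bool
    noLoop : ∀ v → adj v v ≡ false
open Digraph public

Edge : ∀ {n} → Digraph n → Fin n → Fin n → Set
Edge G u v = adj G u v ≡ true

count : ∀ {n} → (Fin n → Bool) → ℕ
count {n} p = length (filterᵇ p (allFin n))

HasCard : ∀ {n} → (Fin n → Set) → ℕ → Set
HasCard {n} P c =
  Σ (List (Fin n)) λ xs → Unique xs × (∀ x → (P x ⇔ (x ∈ xs))) × length xs ≡ c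

_=ᵐ_ : ∀ {n} → Maybe (Fin n) → Fin n → Bool
just x  =ᵐ y = ⌊ x ≟ y ⌋
nothing =ᵐ y = false

-- Spanning subgraphs with all in/out-degrees ≤ 1 are represented by a
-- partial successor function  s : Fin n → Maybe (Fin n)  which is injective
-- on its defined values:  (u , v) is an edge iff  s u ≡ just v.
-- Out-degree ≤ 1 holds by construction, in-degree ≤ 1 is injectivity.

Succ : ℕ → Set
Succ n = Fin n → Maybe (Fin n)

InjSucc : ∀ {n} → Succ n → Set
InjSucc s = ∀ u v w → s u ≡ just w → s v ≡ just w → u ≡ v

IsPCC : ∀ {n} → (Fin n → Fin n → Set) → Succ n → Set
IsPCC R s = InjSucc s × (∀ u v → s u ≡ just v → R u v)

numEdges : ∀ {n} → Succ n → ℕ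
numEdges s = count (λ u → is-just (s u))

MaxPCC : ∀ {n} → Digraph n → Succ n → Set
MaxPCC G s = IsPCC (Edge G) s × (∀ s' → IsPCC (Edge G) s' → numEdges s' ≤ numEdges s)

iter : ∀ {n} → Succ n → ℕ → Fin n → Maybe (Fin n)
iter s zero v = just v
iter s (suc m) v with s v
... | nothing = nothing
... | just w  = iter s m w

OnCycle : ∀ {n} → Succ n → Fin n → Set
OnCycle s v = Σ ℕ λ m → iter s (suc m) v ≡ just v

OutDeg0 : ∀ {n} → Succ n → Fin n → Set
OutDeg0 s u = s u ≡ nothing

InDeg0 : ∀ {n} → Succ n → Fin n → Set
InDeg0 s v = ∀ x → ¬ (s x ≡ just v)

replaceIn : ∀ {n} → Succ n → Fin n → Fin n → Fin n → Succ n
replaceIn s u v w z =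
  if ⌊ z ≟ u ⌋ then just v else (if ⌊ z ≟ w ⌋ then nothing else s z)

replaceOut : ∀ {n} → Succ n → Fin n → Fin n → Succ n
replaceOut s u v z = if ⌊ z ≟ u ⌋ then just v else s z

StepCond : ∀ {n} → Digraph n → Succ n → Fin n → Fin n → Set
StepCond G s u v = Edge G u v × ¬ (s u ≡ just v) ×
  ((OutDeg0 s u × OnCycle s v) ⊎ (InDeg0 s v × OnCycle s u))

data Step {n} (G : Digraph n) (s : Succ n) : Succ n → Set where
  stepIn  : ∀ u v w → Edge G u v → ¬ (s u ≡ just v) → OutDeg0 s u → OnCycle s v →
            s w ≡ just v → Step G s (replaceIn s u v w)
  stepOut : ∀ u v → Edge G u v → ¬ (s u ≡ just v) → InDeg0 s v → OnCycle s u →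
            Step G s (replaceOut s u v)

-- C is a possible outcome of steps (i)-(ii)
IsConstructedC : ∀ {n} → Digraph n → Succ n → Set
IsConstructedC G C = Σ (Succ _) λ C₀ → MaxPCC G C₀ × Star (Step G) C₀ C ×
  (∀ u v → ¬ StepCond G C u v)

CAdj : ∀ {n} → Succ n → Fin n → Fin n → Set
CAdj C x y = (C x ≡ just y) ⊎ (C y ≡ just x)

SameComp : ∀ {n} → Succ n → Fin n → Fin n → Set
SameComp C = Star (CAdj C)

-- x lies on a 2-cycle of C (then that 2-cycle is the component of x)
InTwoCycle : ∀ {n} → Succ n → Fin n → Set
InTwoCycle C x = Σ _ λ y → C x ≡ just y × C y ≡ just x

E₁ : ∀ {n} → Digraph n → Succ n → Fin n → Fin n → Set
E₁ G C u v = Edge G u v × ¬ (C u ≡ just v) × ¬ SameComp C u v ×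
  (InTwoCycle C u ⊎ InTwoCycle C v)

-- Each 2-cycle {u , v} of C is represented by its vertex with smaller index.
twoCycleRep : ∀ {n} → Succ n → Fin n → Bool
twoCycleRep {n} C u with C u
... | nothing = false
... | just v  = (toℕ u <ᵇ toℕ v) ∧ (C v =ᵐ u)

incident : ∀ {n} → Succ n → Fin n → Bool
incident {n} S x = is-just (S x) ∨ any (λ y → S y =ᵐ x) (allFin n)

saturatesRep : ∀ {n} → Succ n → Succ n → Fin n → Bool
saturatesRep C S u with C u
... | nothing = false
... | just v  = incident S u ∨ incident S v

weight : ∀ {n} → Succ n → Succ n → ℕ
weight C S = count (λ u → twoCycleRep C u ∧ saturatesRep C S u)

MaxWeightPCC : ∀ {n} → Digraph n → Succ n → Succ n → Set
MaxWeightPCC G C M = IsPCC (E₁ G C) M ×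
  (∀ M' → IsPCC (E₁ G C) M' → weight C M' ≤ weight C M)

removeAt : ∀ {n} → Succ n → Fin n → Succ n
removeAt M x z = if ⌊ z ≟ x ⌋ then nothing else M z

data Del {n} (C : Succ n) (M : Succ n) : Succ n → Set where
  del : ∀ x y → M x ≡ just y → weight C (removeAt M x) ≡ weight C M →
        Del C M (removeAt M x)

-- M is a possible outcome of step (iv)
IsConstructedM : ∀ {n} → Digraph n → Succ n → Succ n → Set
IsConstructedM G C M = Σ (Succ _) λ M₀ → MaxWeightPCC G C M₀ × Star (Del C) M₀ M ×
  (∀ x y → M x ≡ just y → ¬ (weight C (removeAt M x) ≡ weight C M))

G₂Edge : ∀ {n} → Succ n → Succ n → Fin n → Fin n → Set
G₂Edge C M x y = (C x ≡ just y) ⊎ (M x ≡ just y)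

-- adjacency in G₃ between the components of C containing a and b
G₃Adj : ∀ {n} → Succ n → Succ n → Fin n → Fin n → Set
G₃Adj C M a b = ¬ SameComp C a b ×
  Σ _ λ x → Σ _ λ y → G₂Edge C M x y ×
    ((SameComp C a x × SameComp C b y) ⊎ (SameComp C b x × SameComp C a y))

IsolatedRep : ∀ {n} → Succ n → Succ n → Fin n → Set
IsolatedRep C M u = twoCycleRep C u ≡ true × (∀ b → ¬ G₃Adj C M u b)

record KPathPartition {n} (G : Digraph n) (k : ℕ) : Set where
  field
    paths    : List (List (Fin n))
    nonEmpty : All (λ p → ¬ (p ≡ [])) paths
    bounded  : All (λ p → length p ≤ k) paths
    isPath   : All (Linked (Edge G)) paths
    partition : concat paths ↭ allFin n
open KPathPartition public

size : ∀ {n} {G : Digraph n} {k} → KPathPartition G k → ℕ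
size Q = length (paths Q)

pathEdges : ∀ {n} {G : Digraph n} {k} → KPathPartition G k → ℕ
pathEdges Q = sum (map (λ p → length p ∸ 1) (paths Q))

MinKPathPartition : ∀ {n} (G : Digraph n) k → KPathPartition G k → Set
MinKPathPartition G k Q = ∀ (Q' : KPathPartition G k) → size Q ≤ size Q'

-- Let S be the part of Q lying in G₁, and call a 2-cycle of C unsaturated when S does not touch
-- it; let a be their number.  As M has maximum weight, M leaves at most a 2-cycles unsaturated, and
-- an isolated 2-cycle is one of them, so i ≤ a.  At an unsaturated 2-cycle Q can only use one of
-- the two edges of the 2-cycle itself (it has no 2-cycles), so replacing Q there by C gains at least
-- one edge per such 2-cycle: a path-cycle cover with |E(Q)| + a edges, whence the first bound since
-- C is still maximum (the exchanges of step (ii) keep the number of edges).  A path of Q meeting an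
-- unsaturated 2-cycle lies inside it and has at most two vertices, every other path has at most k;
-- summing over paths, |E(Q)| + (k − 2) a ≤ (k − 1) |Q|, and n = |E(Q)| + |Q| gives the second bound.

module Submission where

open import Defs
open import Data.Bool using (Bool; true; false; _∧_; _∨_; not; if_then_else_)
open import Data.Bool.ListAction using (any)
open import Data.Bool.Properties using (∨-comm; ∨-zeroʳ; ∧-comm; ∧-identityʳ; ∧-zeroʳ; ∧-conicalˡ; T-≡; ¬-not)
open import Data.Empty using (⊥; ⊥-elim)
open import Data.Fin using (Fin; zero; suc; _≟_; toℕ)
open import Data.Fin.Permutation using (permutation)
open import Data.Fin.Properties using (toℕ-injective)
open import Data.List using (List; []; _∷_; length; filterᵇ; map; concat; tabulate; allFin; _++_)
open import Data.List.Membership.Propositional using (_∈_; lose)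
open import Data.List.Membership.Propositional.Properties using (∈-concat⁺′; ∈-allFin)
open import Data.List.Properties using (map-++; length-++; length-tabulate)
open import Data.List.Relation.Binary.Permutation.Propositional using (_↭_; ↭-sym; ↭⇒↭ₛ)
open import Data.List.Relation.Binary.Permutation.Propositional.Properties using (map⁺; ↭-length)
open import Data.List.Relation.Binary.Permutation.Setoid.Properties using (Unique-resp-↭)
open import Data.List.Relation.Unary.All as All using (All; []; _∷_)
open import Data.List.Relation.Unary.All.Properties using (++⁻ˡ; ++⁻ʳ)
open import Data.List.Relation.Unary.AllPairs using ([]; _∷_)
open import Data.List.Relation.Unary.Any using (Any; here; there; satisfied)
open import Data.List.Relation.Unary.Any.Properties using (any⁺; any⁻)
open import Data.List.Relation.Unary.Linked using (Linked; []; [-]; _∷_)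
open import Data.List.Relation.Unary.Unique.Propositional using (Unique)
open import Data.List.Relation.Unary.Unique.Propositional.Properties using (allFin⁺)
open import Data.Maybe using (Maybe; just; nothing; is-just; _<∣>_)
open import Data.Maybe.Properties using (just-injective)
open import Data.Nat using (ℕ; zero; suc; _+_; _*_; _∸_; _≤_; z≤n; s≤s; _<ᵇ_) renaming (_≟_ to _≟ℕ_)
open import Data.Nat.ListAction using (sum)
open import Data.Nat.ListAction.Properties using (sum-++; sum-↭)
open import Data.Nat.Properties hiding (_≟_)
open import Data.Nat.Solver using (module +-*-Solver)
open import Data.Product using (Σ; _×_; _,_; proj₁; proj₂)
import Data.Product
open import Data.Sum using (_⊎_; inj₁; inj₂; [_,_]′)
import Data.Sum
open import Function using (_∘_; id; Equivalence)
open import Relation.Binary.Construct.Closure.ReflexiveTransitive using (Star; ε; _◅_; _◅◅_; reverse)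
open import Relation.Binary.PropositionalEquality
open import Relation.Nullary using (¬_; yes; no)
open import Relation.Nullary.Decidable using (⌊_⌋)

open import Algebra.Properties.CommutativeMonoid.Sum +-0-commutativeMonoid
  using (sum-cong-≗; ∑-distrib-+; sum-permute) renaming (sum to ∑)

-- Counting over Fin n

χ : Bool → ℕ
χ true  = 1
χ false = 0

length-filterᵇ-tabulate : ∀ {A : Set} {n} (p : A → Bool) (g : Fin n → A) →
  length (filterᵇ p (tabulate g)) ≡ ∑ (χ ∘ p ∘ g)
length-filterᵇ-tabulate {n = zero}  p g = refl
length-filterᵇ-tabulate {n = suc n} p g with p (g zero)
... | true  = cong suc (length-filterᵇ-tabulate p (g ∘ suc))
... | false = length-filterᵇ-tabulate p (g ∘ suc)

count≡∑χ : ∀ {n} (p : Fin n → Bool) → count p ≡ ∑ (χ ∘ p)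
count≡∑χ p = length-filterᵇ-tabulate p id

∑-mono-≤ : ∀ {n} {f g : Fin n → ℕ} → (∀ x → f x ≤ g x) → ∑ f ≤ ∑ g
∑-mono-≤ {zero}  f≤g = z≤n
∑-mono-≤ {suc n} f≤g = +-mono-≤ (f≤g zero) (∑-mono-≤ (f≤g ∘ suc))

∑-involution : ∀ {n} (π : Fin n → Fin n) → (∀ x → π (π x) ≡ x) →
  (f : Fin n → ℕ) → ∑ (f ∘ π) ≡ ∑ f
∑-involution π π∘π f = sym (sum-permute f (permutation π π π∘π π∘π))

∑-zero : ∀ {n} (f : Fin n → ℕ) → (∀ x → f x ≡ 0) → ∑ f ≡ 0
∑-zero {zero}  f f≡0 = refl
∑-zero {suc n} f f≡0 rewrite f≡0 zero = ∑-zero (f ∘ suc) (f≡0 ∘ suc)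

∑-χ-≟ : ∀ {n} (u : Fin n) → ∑ (λ x → χ ⌊ x ≟ u ⌋) ≡ 1
∑-χ-≟ {suc n} zero = cong suc (∑-zero {n} (λ x → χ ⌊ suc x ≟ zero ⌋) (λ _ → refl))
∑-χ-≟ {suc n} (suc u) = trans (sum-cong-≗ (cong χ ∘ suc-≟ u)) (∑-χ-≟ u)
  where
  suc-≟ : ∀ {m} (u x : Fin m) → ⌊ suc x ≟ suc u ⌋ ≡ ⌊ x ≟ u ⌋
  suc-≟ u x with x ≟ u
  ... | yes _ = refl
  ... | no  _ = refl

Unique⇒length≤∑χ : ∀ {n} (p : Fin n → Bool) (xs : List (Fin n)) → Unique xs →
  (∀ x → x ∈ xs → p x ≡ true) → length xs ≤ ∑ (χ ∘ p)
Unique⇒length≤∑χ p []       _          _  = z≤n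
Unique⇒length≤∑χ {n} p (x ∷ xs) (x∉xs ∷ u) xs⊆p = begin
  suc (length xs)                              ≡⟨ +-comm 1 (length xs) ⟩
  length xs + 1                                ≤⟨ +-monoˡ-≤ 1 (Unique⇒length≤∑χ p' xs u xs⊆p') ⟩
  ∑ (χ ∘ p') + 1                               ≡⟨ cong (∑ (χ ∘ p') +_) (sym (∑-χ-≟ x)) ⟩
  ∑ (χ ∘ p') + ∑ (λ y → χ ⌊ y ≟ x ⌋)           ≡⟨ ∑-distrib-+ (χ ∘ p') _ ⟨
  ∑ (λ y → χ (p' y) + χ ⌊ y ≟ x ⌋)             ≡⟨ sum-cong-≗ split ⟩
  ∑ (χ ∘ p)                                    ∎
  where
  open ≤-Reasoning
  p' : Fin n → Bool
  p' y = p y ∧ not ⌊ y ≟ x ⌋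
  xs⊆p' : ∀ y → y ∈ xs → p' y ≡ true
  xs⊆p' y y∈xs with y ≟ x
  ... | yes refl = ⊥-elim (All.lookup x∉xs y∈xs refl)
  ... | no  _    = trans (∧-identityʳ (p y)) (xs⊆p y (there y∈xs))
  split : ∀ y → χ (p' y) + χ ⌊ y ≟ x ⌋ ≡ χ (p y)
  split y with y ≟ x
  ... | yes refl rewrite xs⊆p x (here refl) = refl
  ... | no  _    = trans (+-identityʳ _) (cong χ (∧-identityʳ (p y)))

sum-map-tabulate : ∀ {A : Set} {n} (f : A → ℕ) (g : Fin n → A) →
  sum (map f (tabulate g)) ≡ ∑ (f ∘ g)
sum-map-tabulate {n = zero}  f g = refl
sum-map-tabulate {n = suc n} f g = cong (f (g zero) +_) (sum-map-tabulate f (g ∘ suc))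

sum-map-concat : ∀ {A : Set} (f : A → ℕ) (xss : List (List A)) →
  sum (map f (concat xss)) ≡ sum (map (sum ∘ map f) xss)
sum-map-concat f []         = refl
sum-map-concat f (xs ∷ xss) = begin
  sum (map f (xs ++ concat xss))                ≡⟨ cong sum (map-++ f xs (concat xss)) ⟩
  sum (map f xs ++ map f (concat xss))          ≡⟨ sum-++ (map f xs) (map f (concat xss)) ⟩
  sum (map f xs) + sum (map f (concat xss))     ≡⟨ cong (sum (map f xs) +_) (sum-map-concat f xss) ⟩
  sum (map f xs) + sum (map (sum ∘ map f) xss)  ∎
  where open ≡-Reasoning

∑≡sum-over-partition : ∀ {n} (f : Fin n → ℕ) (xss : List (List (Fin n))) →
  concat xss ↭ allFin n → ∑ f ≡ sum (map (sum ∘ map f) xss)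
∑≡sum-over-partition f xss xss↭allFin = begin
  ∑ f                             ≡⟨ sum-map-tabulate f id ⟨
  sum (map f (allFin _))          ≡⟨ sum-↭ (map⁺ f (↭-sym xss↭allFin)) ⟩
  sum (map f (concat xss))        ≡⟨ sum-map-concat f xss ⟩
  sum (map (sum ∘ map f) xss)     ∎
  where open ≡-Reasoning

sum-map-mono-≤ : ∀ {A : Set} {f g : A → ℕ} {xs} → All (λ x → f x ≤ g x) xs →
  sum (map f xs) ≤ sum (map g xs)
sum-map-mono-≤ []           = z≤n
sum-map-mono-≤ (fx≤gx ∷ hs) = +-mono-≤ fx≤gx (sum-map-mono-≤ hs)

sum-map-linear-≤ : ∀ {A : Set} (f g : A → ℕ) (a c d : ℕ) {xs : List A} →
  All (λ x → a * f x + c * g x ≤ d) xs →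
  a * sum (map f xs) + c * sum (map g xs) ≤ length xs * d
sum-map-linear-≤ f g a c d []                     = ≤-reflexive (cong₂ _+_ (*-zeroʳ a) (*-zeroʳ c))
sum-map-linear-≤ f g a c d {x ∷ xs} (bound ∷ bounds) = begin
  a * (f x + F) + c * (g x + G)        ≡⟨ rearrange a c (f x) F (g x) G ⟩
  (a * f x + c * g x) + (a * F + c * G) ≤⟨ +-mono-≤ bound (sum-map-linear-≤ f g a c d bounds) ⟩
  d + length xs * d                    ∎
  where
  open ≤-Reasoning
  open +-*-Solver
  F G : ℕ
  F = sum (map f xs)
  G = sum (map g xs)
  rearrange : ∀ a c u U v V → a * (u + U) + c * (v + V) ≡ (a * u + c * v) + (a * U + c * V)
  rearrange = solve 6 (λ a c u U v V → a :* (u :+ U) :+ c :* (v :+ V) :=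
                                       (a :* u :+ c :* v) :+ (a :* U :+ c :* V)) refl

length-concat : ∀ {A : Set} (xss : List (List A)) → length (concat xss) ≡ sum (map length xss)
length-concat []         = refl
length-concat (xs ∷ xss) = trans (length-++ xs) (cong (length xs +_) (length-concat xss))

sum-map-length : ∀ {A : Set} (xss : List (List A)) → All (λ xs → ¬ xs ≡ []) xss →
  sum (map length xss) ≡ sum (map (λ xs → length xs ∸ 1) xss) + length xss
sum-map-length []               []            = refl
sum-map-length ([] ∷ xss)       ([]≢[] ∷ _)   = ⊥-elim ([]≢[] refl)
sum-map-length ((x ∷ xs) ∷ xss) (_ ∷ nonempty) = begin
  suc (length xs + sum (map length xss))           ≡⟨ cong (λ t → suc (length xs + t)) (sum-map-length xss nonempty) ⟩
  suc (length xs + (S + length xss))               ≡⟨ cong suc (+-assoc (length xs) S (length xss)) ⟨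
  suc (length xs + S + length xss)                 ≡⟨ +-suc (length xs + S) (length xss) ⟨
  length xs + S + suc (length xss)                 ∎
  where
  open ≡-Reasoning
  S : ℕ
  S = sum (map (λ xs → length xs ∸ 1) xss)

-- The constructed C and M

nothing≢just : ∀ {A : Set} {x : A} → nothing ≢ just x
nothing≢just ()

edgeCount : ∀ {n} → Succ n → Fin n → ℕ
edgeCount s x = χ (is-just (s x))

numEdges≡∑edgeCount : ∀ {n} (s : Succ n) → numEdges s ≡ ∑ (edgeCount s)
numEdges≡∑edgeCount s = count≡∑χ (is-just ∘ s)

module _ {n} {G : Digraph n} where

  Step-preserves-IsPCC : ∀ {s t} → Step G s t → IsPCC (Edge G) s → IsPCC (Edge G) t
  Step-preserves-IsPCC {s} (stepIn u v w uv _ _ _ wv) (s-inj , s-edge) = t-inj , t-edge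
    where
    t : Succ n
    t = replaceIn s u v w
    t-inj : InjSucc t
    t-inj a b c ta tb with a ≟ u | b ≟ u
    ... | yes a≡u | yes b≡u = trans a≡u (sym b≡u)
    t-inj a b c ta tb | yes _ | no _ with b ≟ w
    ... | yes _   = ⊥-elim (nothing≢just tb)
    ... | no b≢w  = ⊥-elim (b≢w (s-inj b w v (trans tb (sym ta)) wv))
    t-inj a b c ta tb | no _ | yes _ with a ≟ w
    ... | yes _   = ⊥-elim (nothing≢just ta)
    ... | no a≢w  = ⊥-elim (a≢w (s-inj a w v (trans ta (sym tb)) wv))
    t-inj a b c ta tb | no _ | no _ with a ≟ w | b ≟ w
    ... | yes _ | _     = ⊥-elim (nothing≢just ta)
    ... | no _  | yes _ = ⊥-elim (nothing≢just tb)
    ... | no _  | no _  = s-inj a b c ta tb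
    t-edge : ∀ a b → t a ≡ just b → Edge G a b
    t-edge a b ta with a ≟ u
    ... | yes refl = subst (Edge G a) (just-injective ta) uv
    ... | no _ with a ≟ w
    ...   | yes _ = ⊥-elim (nothing≢just ta)
    ...   | no _  = s-edge a b ta
  Step-preserves-IsPCC {s} (stepOut u v uv _ v-free _) (s-inj , s-edge) = t-inj , t-edge
    where
    t : Succ n
    t = replaceOut s u v
    t-inj : InjSucc t
    t-inj a b c ta tb with a ≟ u | b ≟ u
    ... | yes a≡u | yes b≡u = trans a≡u (sym b≡u)
    ... | yes _   | no _    = ⊥-elim (v-free b (trans tb (sym ta)))
    ... | no _    | yes _   = ⊥-elim (v-free a (trans ta (sym tb)))
    ... | no _    | no _    = s-inj a b c ta tb
    t-edge : ∀ a b → t a ≡ just b → Edge G a b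
    t-edge a b ta with a ≟ u
    ... | yes refl = subst (Edge G a) (just-injective ta) uv
    ... | no _     = s-edge a b ta

  -- stepIn moves an out-edge from w to u; stepOut redirects the out-edge of u.
  Step-preserves-numEdges : ∀ {s t} → Step G s t → numEdges t ≡ numEdges s
  Step-preserves-numEdges {s} (stepIn u v w _ _ u-free _ wv) = begin
    numEdges t                                  ≡⟨ numEdges≡∑edgeCount t ⟩
    ∑ (edgeCount t)                             ≡⟨ +-cancelʳ-≡ 1 _ _ moved ⟩
    ∑ (edgeCount s)                             ≡⟨ numEdges≡∑edgeCount s ⟨
    numEdges s                                  ∎
    where
    open ≡-Reasoning
    t : Succ n
    t = replaceIn s u v w
    pointwise : ∀ x → edgeCount t x + χ ⌊ x ≟ w ⌋ ≡ edgeCount s x + χ ⌊ x ≟ u ⌋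
    pointwise x with x ≟ u
    pointwise x | yes refl with x ≟ w
    ... | yes refl = ⊥-elim (nothing≢just (trans (sym u-free) wv))
    ... | no _ rewrite u-free = refl
    pointwise x | no _ with x ≟ w
    ... | yes refl rewrite wv = refl
    ... | no _ = refl
    moved : ∑ (edgeCount t) + 1 ≡ ∑ (edgeCount s) + 1
    moved = begin
      ∑ (edgeCount t) + 1                              ≡⟨ cong (∑ (edgeCount t) +_) (∑-χ-≟ w) ⟨
      ∑ (edgeCount t) + ∑ (λ x → χ ⌊ x ≟ w ⌋)          ≡⟨ ∑-distrib-+ (edgeCount t) _ ⟨
      ∑ (λ x → edgeCount t x + χ ⌊ x ≟ w ⌋)            ≡⟨ sum-cong-≗ pointwise ⟩
      ∑ (λ x → edgeCount s x + χ ⌊ x ≟ u ⌋)            ≡⟨ ∑-distrib-+ (edgeCount s) _ ⟩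
      ∑ (edgeCount s) + ∑ (λ x → χ ⌊ x ≟ u ⌋)          ≡⟨ cong (∑ (edgeCount s) +_) (∑-χ-≟ u) ⟩
      ∑ (edgeCount s) + 1                              ∎
  Step-preserves-numEdges {s} (stepOut u v _ _ _ (m , u-cycle)) = begin
    numEdges t          ≡⟨ numEdges≡∑edgeCount t ⟩
    ∑ (edgeCount t)     ≡⟨ sum-cong-≗ pointwise ⟩
    ∑ (edgeCount s)     ≡⟨ numEdges≡∑edgeCount s ⟨
    numEdges s          ∎
    where
    open ≡-Reasoning
    t : Succ n
    t = replaceOut s u v
    has-out : ∀ m → iter s (suc m) u ≡ just u → is-just (s u) ≡ true
    has-out m cycle with s u
    ... | just _  = refl
    ... | nothing = ⊥-elim (nothing≢just cycle)
    pointwise : ∀ x → edgeCount t x ≡ edgeCount s x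
    pointwise x with x ≟ u
    ... | yes refl = cong χ (sym (has-out m u-cycle))
    ... | no _     = refl

  Star-Step-preserves : ∀ {s t} → Star (Step G) s t → IsPCC (Edge G) s →
    IsPCC (Edge G) t × numEdges t ≡ numEdges s
  Star-Step-preserves ε               pcc = pcc , refl
  Star-Step-preserves (step ◅ steps) pcc with Star-Step-preserves steps (Step-preserves-IsPCC step pcc)
  ... | pcc′ , same = pcc′ , trans same (Step-preserves-numEdges step)

  IsConstructedC⇒MaxPCC : ∀ {C} → IsConstructedC G C → MaxPCC G C
  IsConstructedC⇒MaxPCC (C₀ , (C₀-pcc , C₀-max) , steps , _)
    with Star-Step-preserves steps C₀-pcc
  ... | C-pcc , same = C-pcc , λ s s-pcc → ≤-trans (C₀-max s s-pcc) (≤-reflexive (sym same))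

module _ {n : ℕ} where

  _⊆ˢ_ : Succ n → Succ n → Set
  s ⊆ˢ t = ∀ x y → s x ≡ just y → t x ≡ just y

  IsPCC-⊆ˢ : ∀ {R : Fin n → Fin n → Set} {s t} → s ⊆ˢ t → IsPCC R t → IsPCC R s
  IsPCC-⊆ˢ s⊆t (t-inj , t-edge) =
    (λ u v w su sv → t-inj u v w (s⊆t u w su) (s⊆t v w sv)) ,
    (λ u v su → t-edge u v (s⊆t u v su))

  removeAt-⊆ˢ : ∀ (M : Succ n) x → removeAt M x ⊆ˢ M
  removeAt-⊆ˢ M x z y e with z ≟ x
  ... | yes _ = ⊥-elim (nothing≢just e)
  ... | no _  = e

  Star-Del-preserves : ∀ {C M₀ M : Succ n} → Star (Del C) M₀ M → M ⊆ˢ M₀ × weight C M ≡ weight C M₀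
  Star-Del-preserves ε = (λ _ _ e → e) , refl
  Star-Del-preserves {M₀ = M₀} (del x _ _ same ◅ dels) with Star-Del-preserves dels
  ... | M⊆ , same′ = (λ u v e → removeAt-⊆ˢ M₀ x u v (M⊆ u v e)) , trans same′ same

  IsConstructedM⇒MaxWeightPCC : ∀ {G : Digraph n} {C M} → IsConstructedM G C M → MaxWeightPCC G C M
  IsConstructedM⇒MaxWeightPCC (M₀ , (M₀-pcc , M₀-max) , dels , _) with Star-Del-preserves dels
  ... | M⊆M₀ , same = IsPCC-⊆ˢ M⊆M₀ M₀-pcc , λ M′ M′-pcc → ≤-trans (M₀-max M′ M′-pcc) (≤-reflexive (sym same))

-- The successor function of a path partition

module _ {n : ℕ} where

  pathSucc : List (Fin n) → Succ n
  pathSucc []          x = nothing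
  pathSucc (a ∷ [])    x = nothing
  pathSucc (a ∷ b ∷ r) x = if ⌊ x ≟ a ⌋ then just b else pathSucc (b ∷ r) x

  pathsSucc : List (List (Fin n)) → Succ n
  pathsSucc []       x = nothing
  pathsSucc (p ∷ ps) x = pathSucc p x <∣> pathsSucc ps x

  Unique-++⁻ : ∀ (xs : List (Fin n)) {ys} → Unique (xs ++ ys) →
    Unique xs × Unique ys × (∀ {z} → z ∈ xs → z ∈ ys → ⊥)
  Unique-++⁻ []       u          = [] , u , λ ()
  Unique-++⁻ (x ∷ xs) (x∉ ∷ u) with Unique-++⁻ xs u
  ... | uxs , uys , disjoint = ++⁻ˡ xs x∉ ∷ uxs , uys , disjoint′
    where
    disjoint′ : ∀ {z} → z ∈ x ∷ xs → z ∈ _ → ⊥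
    disjoint′ (here refl) z∈ys = All.lookup (++⁻ʳ xs x∉) z∈ys refl
    disjoint′ (there z∈xs) z∈ys = disjoint z∈xs z∈ys

  Unique-concat⁻ : ∀ {ps : List (List (Fin n))} → Unique (concat ps) → ∀ {p} → p ∈ ps → Unique p
  Unique-concat⁻ {q ∷ ps} u (here refl) = proj₁ (Unique-++⁻ q u)
  Unique-concat⁻ {q ∷ ps} u (there p∈) = Unique-concat⁻ (proj₁ (proj₂ (Unique-++⁻ q u))) p∈

  pathSucc-∈ : ∀ p {x y} → pathSucc p x ≡ just y → x ∈ p × y ∈ p
  pathSucc-∈ (a ∷ b ∷ r) {x} e with x ≟ a | pathSucc-∈ (b ∷ r) {x}
  ... | yes refl | _       = here refl , subst (_∈ a ∷ b ∷ r) (just-injective e) (there (here refl))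
  ... | no _     | in-tail = Data.Product.map there there (in-tail e)

  pathSucc-∈-tail : ∀ a r {x y} → pathSucc (a ∷ r) x ≡ just y → y ∈ r
  pathSucc-∈-tail a (b ∷ r) {x} e with x ≟ a
  ... | yes refl = subst (_∈ b ∷ r) (just-injective e) (here refl)
  ... | no _     = proj₂ (pathSucc-∈ (b ∷ r) e)

  pathSucc-Linked : ∀ {R : Fin n → Fin n → Set} {p} → Linked R p →
    ∀ {x y} → pathSucc p x ≡ just y → R x y
  pathSucc-Linked {R} {a ∷ b ∷ r} (Rab ∷ linked) {x} e with x ≟ a | pathSucc-Linked linked {x}
  ... | yes refl | _       = subst (R x) (just-injective e) Rab
  ... | no _     | in-tail = in-tail e

  pathSucc-injective : ∀ p → Unique p → ∀ {u v w} →
    pathSucc p u ≡ just w → pathSucc p v ≡ just w → u ≡ v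
  pathSucc-injective (a ∷ b ∷ r) (_ ∷ (b∉r ∷ ur)) {u} {v} eu ev
    with u ≟ a | v ≟ a | pathSucc-injective (b ∷ r) (b∉r ∷ ur) {u} {v}
  ... | yes refl | yes refl | _       = refl
  ... | yes refl | no _     | _       = ⊥-elim (All.lookup b∉r (subst (_∈ r) (sym (just-injective eu)) (pathSucc-∈-tail b r ev)) refl)
  ... | no _     | yes refl | _       = ⊥-elim (All.lookup b∉r (subst (_∈ r) (sym (just-injective ev)) (pathSucc-∈-tail b r eu)) refl)
  ... | no _     | no _     | in-tail = in-tail eu ev

  pathSucc-no-2-cycle : ∀ p → Unique p → ∀ {x y} → pathSucc p x ≡ just y → ¬ pathSucc p y ≡ just x
  pathSucc-no-2-cycle (a ∷ b ∷ r) (a∉ ∷ u) {x} {y} ex ey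
    with x ≟ a | y ≟ a | pathSucc-no-2-cycle (b ∷ r) u {x} {y}
  ... | yes refl | yes refl | _       = All.lookup a∉ (subst (_∈ b ∷ r) (just-injective ex) (here refl)) refl
  ... | yes refl | no _     | _       = All.lookup a∉ (proj₂ (pathSucc-∈ (b ∷ r) ey)) refl
  ... | no _     | yes refl | _       = All.lookup a∉ (proj₂ (pathSucc-∈ (b ∷ r) ex)) refl
  ... | no _     | no _     | in-tail = in-tail ex ey

  <∣>-just : ∀ {m m′ : Maybe (Fin n)} {y} → (m <∣> m′) ≡ just y → m ≡ just y ⊎ (m ≡ nothing × m′ ≡ just y)
  <∣>-just {just _}  e = inj₁ e
  <∣>-just {nothing} e = inj₂ (refl , e)

  pathsSucc-step : ∀ ps {x y} → pathsSucc ps x ≡ just y → Σ (List (Fin n)) λ p → p ∈ ps × pathSucc p x ≡ just y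
  pathsSucc-step (p ∷ ps) {x} e with <∣>-just {pathSucc p x} e
  ... | inj₁ e′       = p , here refl , e′
  ... | inj₂ (_ , e′) with pathsSucc-step ps e′
  ...   | q , q∈ , eq = q , there q∈ , eq

  pathsSucc-∈ : ∀ ps {x y} → pathsSucc ps x ≡ just y → x ∈ concat ps × y ∈ concat ps
  pathsSucc-∈ ps e with pathsSucc-step ps e
  ... | p , p∈ , e′ = Data.Product.map (λ x∈ → ∈-concat⁺′ x∈ p∈) (λ y∈ → ∈-concat⁺′ y∈ p∈) (pathSucc-∈ p e′)

  pathsSucc-Linked : ∀ {R : Fin n → Fin n → Set} ps → All (Linked R) ps →
    ∀ {x y} → pathsSucc ps x ≡ just y → R x y
  pathsSucc-Linked ps linked e with pathsSucc-step ps e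
  ... | p , p∈ , e′ = pathSucc-Linked (All.lookup linked p∈) e′

  pathsSucc-injective : ∀ ps → Unique (concat ps) → InjSucc (pathsSucc ps)
  pathsSucc-injective (p ∷ ps) U u v w eu ev with Unique-++⁻ p U
  ... | up , ups , disjoint with <∣>-just {pathSucc p u} eu | <∣>-just {pathSucc p v} ev
  ... | inj₁ pu       | inj₁ pv       = pathSucc-injective p up pu pv
  ... | inj₁ pu       | inj₂ (_ , pv) = ⊥-elim (disjoint (proj₂ (pathSucc-∈ p pu)) (proj₂ (pathsSucc-∈ ps pv)))
  ... | inj₂ (_ , pu) | inj₁ pv       = ⊥-elim (disjoint (proj₂ (pathSucc-∈ p pv)) (proj₂ (pathsSucc-∈ ps pu)))
  ... | inj₂ (_ , pu) | inj₂ (_ , pv) = pathsSucc-injective ps ups u v w pu pv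

  pathsSucc-no-2-cycle : ∀ ps → Unique (concat ps) → ∀ {x y} →
    pathsSucc ps x ≡ just y → ¬ pathsSucc ps y ≡ just x
  pathsSucc-no-2-cycle (p ∷ ps) U {x} {y} ex ey with Unique-++⁻ p U
  ... | up , ups , disjoint with <∣>-just {pathSucc p x} ex | <∣>-just {pathSucc p y} ey
  ... | inj₁ px       | inj₁ py       = pathSucc-no-2-cycle p up px py
  ... | inj₁ px       | inj₂ (_ , py) = disjoint (proj₂ (pathSucc-∈ p px)) (proj₁ (pathsSucc-∈ ps py))
  ... | inj₂ (_ , px) | inj₁ py       = disjoint (proj₂ (pathSucc-∈ p py)) (proj₁ (pathsSucc-∈ ps px))
  ... | inj₂ (_ , px) | inj₂ (_ , py) = pathsSucc-no-2-cycle ps ups px py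

  pathSucc⊆pathsSucc : ∀ ps → Unique (concat ps) → ∀ {p} → p ∈ ps → pathSucc p ⊆ˢ pathsSucc ps
  pathSucc⊆pathsSucc (q ∷ ps) U (here refl) x y e rewrite e = refl
  pathSucc⊆pathsSucc (q ∷ ps) U {p} (there p∈) x y e with Unique-++⁻ q U | pathSucc q x in eq
  ... | _ , _ , disjoint | just _  = ⊥-elim (disjoint (proj₁ (pathSucc-∈ q eq)) (∈-concat⁺′ (proj₁ (pathSucc-∈ p e)) p∈))
  ... | _ , ups , _      | nothing = pathSucc⊆pathsSucc ps ups p∈ x y e

  Linked-by : ∀ (s : Succ n) p → Unique p → pathSucc p ⊆ˢ s → Linked (λ x y → s x ≡ just y) p
  Linked-by s []          _          _  = []
  Linked-by s (a ∷ [])    _          _  = [-]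
  Linked-by s (a ∷ b ∷ r) (a∉ ∷ u) p⊆s = p⊆s a b head-step ∷ Linked-by s (b ∷ r) u tail⊆s
    where
    head-step : pathSucc (a ∷ b ∷ r) a ≡ just b
    head-step with a ≟ a
    ... | yes _  = refl
    ... | no a≢a = ⊥-elim (a≢a refl)
    tail⊆s : pathSucc (b ∷ r) ⊆ˢ s
    tail⊆s x y e with x ≟ a in eq
    ... | yes refl = ⊥-elim (All.lookup a∉ (proj₁ (pathSucc-∈ (b ∷ r) e)) refl)
    ... | no _     = p⊆s x y (subst (λ d → (if ⌊ d ⌋ then just b else pathSucc (b ∷ r) x) ≡ just y) (sym eq) e)

  Linked-by⇒length∸1≤ : ∀ (s : Succ n) {p} → Linked (λ x y → s x ≡ just y) p →
    length p ∸ 1 ≤ sum (map (edgeCount s) p)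
  Linked-by⇒length∸1≤ s []                 = z≤n
  Linked-by⇒length∸1≤ s [-]                = z≤n
  Linked-by⇒length∸1≤ s (sa≡b ∷ linked) rewrite sa≡b = s≤s (Linked-by⇒length∸1≤ s linked)

-- 2-cycles of C

∨-≡-true : ∀ {a b} → (a ∨ b) ≡ true → a ≡ true ⊎ b ≡ true
∨-≡-true {true}  _ = inj₁ refl
∨-≡-true {false} e = inj₂ e

any-≡-true⁺ : ∀ {A : Set} (p : A → Bool) {xs y} → y ∈ xs → p y ≡ true → any p xs ≡ true
any-≡-true⁺ p y∈xs py = Equivalence.to T-≡ (any⁺ p (lose y∈xs (Equivalence.from T-≡ py)))

any-≡-true⁻ : ∀ {A : Set} (p : A → Bool) xs → any p xs ≡ true → Σ A λ y → p y ≡ true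
any-≡-true⁻ p xs e with satisfied (any⁻ p xs (Equivalence.from T-≡ e))
... | y , py = y , Equivalence.to T-≡ py

module _ {n : ℕ} where

  =ᵐ-true⁻ : ∀ (m : Maybe (Fin n)) y → (m =ᵐ y) ≡ true → m ≡ just y
  =ᵐ-true⁻ (just x) y e with x ≟ y
  ... | yes refl = refl
  =ᵐ-true⁻ (just x) y () | no _

  =ᵐ-true⁺ : ∀ (m : Maybe (Fin n)) {y} → m ≡ just y → (m =ᵐ y) ≡ true
  =ᵐ-true⁺ (just x) refl with x ≟ x
  ... | yes _  = refl
  ... | no x≢x = ⊥-elim (x≢x refl)

  incident-out : ∀ (S : Succ n) {x y} → S x ≡ just y → incident S x ≡ true
  incident-out S e rewrite e = refl

  incident-in : ∀ (S : Succ n) {x y} → S y ≡ just x → incident S x ≡ true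
  incident-in S {x} {y} e =
    trans (cong (is-just (S x) ∨_) (any-≡-true⁺ _ (∈-allFin y) (=ᵐ-true⁺ (S y) e))) (∨-zeroʳ _)

  SameComp-sym : ∀ {C : Succ n} {x y} → SameComp C x y → SameComp C y x
  SameComp-sym = reverse CAdj-sym
    where
    CAdj-sym : ∀ {C : Succ n} {a b} → CAdj C a b → CAdj C b a
    CAdj-sym (inj₁ c) = inj₂ c
    CAdj-sym (inj₂ c) = inj₁ c

module TwoCycles {n} (G : Digraph n) (C : Succ n) (C-pcc : IsPCC (Edge G) C) where

  C-injective : InjSucc C
  C-injective = proj₁ C-pcc

  onTwoCycle : Fin n → Bool
  onTwoCycle x with C x
  ... | nothing = false
  ... | just y  = C y =ᵐ x

  -- the other vertex of the 2-cycle through x, and x itself when there is none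
  mate : Fin n → Fin n
  mate x with C x
  ... | nothing = x
  ... | just y  = if C y =ᵐ x then y else x

  onTwoCycle⁻ : ∀ x → onTwoCycle x ≡ true → C x ≡ just (mate x) × C (mate x) ≡ just x
  onTwoCycle⁻ x e with C x
  ... | just y rewrite e = refl , =ᵐ-true⁻ (C y) x e

  onTwoCycle⁺ : ∀ x y → C x ≡ just y → C y ≡ just x → onTwoCycle x ≡ true × mate x ≡ y
  onTwoCycle⁺ x y cx cy rewrite cx | =ᵐ-true⁺ (C y) cy = refl , refl

  mate-off : ∀ x → onTwoCycle x ≡ false → mate x ≡ x
  mate-off x e with C x
  ... | nothing = refl
  ... | just y rewrite e = refl

  mate-involutive : ∀ x → mate (mate x) ≡ x
  mate-involutive x with onTwoCycle x in e
  ... | true  = proj₂ (onTwoCycle⁺ (mate x) x (proj₂ (onTwoCycle⁻ x e)) (proj₁ (onTwoCycle⁻ x e)))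
  ... | false = trans (cong mate (mate-off x e)) (mate-off x e)

  mate≡⇒≡mate : ∀ {x y} → x ≡ mate y → y ≡ mate x
  mate≡⇒≡mate {y = y} refl = sym (mate-involutive y)

  onTwoCycle-mate : ∀ x → onTwoCycle (mate x) ≡ onTwoCycle x
  onTwoCycle-mate x with onTwoCycle x in e
  ... | true  = proj₁ (onTwoCycle⁺ (mate x) x (proj₂ (onTwoCycle⁻ x e)) (proj₁ (onTwoCycle⁻ x e)))
  ... | false = trans (cong onTwoCycle (mate-off x e)) e

  mate≢ : ∀ x → onTwoCycle x ≡ true → mate x ≢ x
  mate≢ x e mate≡x with proj₂ C-pcc x x (trans (proj₁ (onTwoCycle⁻ x e)) (cong just mate≡x))
  ... | loop with () ← trans (sym loop) (noLoop G x)

  twoCycleRep≡ : ∀ u → twoCycleRep C u ≡ (onTwoCycle u ∧ (toℕ u <ᵇ toℕ (mate u)))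
  twoCycleRep≡ u with C u
  ... | nothing = refl
  ... | just v with C v =ᵐ u
  ...   | true  = ∧-comm (toℕ u <ᵇ toℕ v) true
  ...   | false = ∧-comm (toℕ u <ᵇ toℕ v) false

  saturatesRep≡ : ∀ (S : Succ n) u → onTwoCycle u ≡ true →
    saturatesRep C S u ≡ (incident S u ∨ incident S (mate u))
  saturatesRep≡ S u e with C u
  ... | just v rewrite e = refl

  SameComp-twoCycle : ∀ x → onTwoCycle x ≡ true → ∀ {z} → SameComp C x z → z ≡ x ⊎ z ≡ mate x
  SameComp-twoCycle x e = go (inj₁ refl)
    where
    cx : C x ≡ just (mate x)
    cx = proj₁ (onTwoCycle⁻ x e)
    cmx : C (mate x) ≡ just x
    cmx = proj₂ (onTwoCycle⁻ x e)
    step : ∀ {z w} → z ≡ x ⊎ z ≡ mate x → CAdj C z w → w ≡ x ⊎ w ≡ mate x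
    step (inj₁ refl) (inj₁ c) = inj₂ (just-injective (trans (sym c) cx))
    step (inj₁ refl) (inj₂ c) = inj₂ (C-injective _ _ _ c cmx)
    step (inj₂ refl) (inj₁ c) = inj₁ (just-injective (trans (sym c) cmx))
    step (inj₂ refl) (inj₂ c) = inj₁ (C-injective _ _ _ c cx)
    go : ∀ {z w} → z ≡ x ⊎ z ≡ mate x → SameComp C z w → w ≡ x ⊎ w ≡ mate x
    go h ε            = h
    go h (c ◅ rest)   = go (step h c) rest

  twoCycleRep⇒onTwoCycle : ∀ u → twoCycleRep C u ≡ true → onTwoCycle u ≡ true
  twoCycleRep⇒onTwoCycle u rep = ∧-conicalˡ _ _ (trans (sym (twoCycleRep≡ u)) rep)

  χ-rep+χ-rep-mate : ∀ x → onTwoCycle x ≡ true →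
    χ (twoCycleRep C x) + χ (twoCycleRep C (mate x)) ≡ 1
  χ-rep+χ-rep-mate x e
    rewrite twoCycleRep≡ x | twoCycleRep≡ (mate x) | onTwoCycle-mate x | mate-involutive x | e =
    χ-<ᵇ-total (toℕ x) (toℕ (mate x)) (λ eq → mate≢ x e (sym (toℕ-injective eq)))
    where
    χ-<ᵇ-total : ∀ a b → a ≢ b → χ (a <ᵇ b) + χ (b <ᵇ a) ≡ 1
    χ-<ᵇ-total zero    zero    a≢b = ⊥-elim (a≢b refl)
    χ-<ᵇ-total zero    (suc b) _   = refl
    χ-<ᵇ-total (suc a) zero    _   = refl
    χ-<ᵇ-total (suc a) (suc b) a≢b = χ-<ᵇ-total a b (a≢b ∘ cong suc)

module _ {n : ℕ} (C : Succ n) where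

  unsaturatedCount : Succ n → ℕ
  unsaturatedCount X = ∑ (λ u → χ (twoCycleRep C u ∧ not (saturatesRep C X u)))

  weight+unsaturatedCount : ∀ X → weight C X + unsaturatedCount X ≡ ∑ (χ ∘ twoCycleRep C)
  weight+unsaturatedCount X = begin
    weight C X + unsaturatedCount X                     ≡⟨ cong (_+ unsaturatedCount X) (count≡∑χ saturated) ⟩
    ∑ (χ ∘ saturated) + unsaturatedCount X              ≡⟨ ∑-distrib-+ (χ ∘ saturated) _ ⟨
    ∑ (λ u → χ (saturated u) + χ (unsaturated u))       ≡⟨ sum-cong-≗ split ⟩
    ∑ (χ ∘ twoCycleRep C)                               ∎
    where
    open ≡-Reasoning
    saturated unsaturated : Fin n → Bool
    saturated   u = twoCycleRep C u ∧ saturatesRep C X u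
    unsaturated u = twoCycleRep C u ∧ not (saturatesRep C X u)
    split : ∀ u → χ (saturated u) + χ (unsaturated u) ≡ χ (twoCycleRep C u)
    split u with twoCycleRep C u | saturatesRep C X u
    ... | true  | true  = refl
    ... | true  | false = refl
    ... | false | _     = refl

  unsaturatedCount-antitone : ∀ X Y → weight C X ≤ weight C Y → unsaturatedCount Y ≤ unsaturatedCount X
  unsaturatedCount-antitone X Y wX≤wY = +-cancelˡ-≤ (weight C X) _ _ (begin
    weight C X + unsaturatedCount Y     ≤⟨ +-monoˡ-≤ (unsaturatedCount Y) wX≤wY ⟩
    weight C Y + unsaturatedCount Y     ≡⟨ weight+unsaturatedCount Y ⟩
    ∑ (χ ∘ twoCycleRep C)               ≡⟨ weight+unsaturatedCount X ⟨
    weight C X + unsaturatedCount X     ∎)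
    where open ≤-Reasoning

E₁⇒¬SameComp : ∀ {n} {G : Digraph n} {C : Succ n} {x y} → E₁ G C x y → ¬ SameComp C x y
E₁⇒¬SameComp (_ , _ , x≁y , _) = x≁y

module _ {n} {G : Digraph n} {C : Succ n} (C-pcc : IsPCC (Edge G) C) where
  open TwoCycles G C C-pcc

  module _ {M} (M⊆E₁ : ∀ x y → M x ≡ just y → E₁ G C x y) {u} (isolated : ∀ b → ¬ G₃Adj C M u b) where

    -- an edge of M at the component of u leaves it, so it would be an edge of G₃ at u
    isolated⇒¬incident : ∀ z → SameComp C u z → incident M z ≡ false
    isolated⇒¬incident z u~z = ¬-not (incident-absurd (incident M z) refl)
      where
      incident-absurd : ∀ b → incident M z ≡ b → b ≢ true
      incident-absurd _ inc refl with ∨-≡-true {is-just (M z)} inc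
      incident-absurd _ inc refl | inj₁ out with M z in mz
      ... | just w = isolated w (u≁w , z , w , inj₂ mz , inj₁ (u~z , ε))
        where
        u≁w : ¬ SameComp C u w
        u≁w u~w = E₁⇒¬SameComp {G = G} (M⊆E₁ z w mz) (SameComp-sym u~z ◅◅ u~w)
      incident-absurd _ inc refl | inj₂ into with any-≡-true⁻ (λ y → M y =ᵐ z) (allFin n) into
      ... | y , myz = isolated y (u≁y , y , z , inj₂ my≡z , inj₂ (ε , u~z))
        where
        my≡z : M y ≡ just z
        my≡z = =ᵐ-true⁻ (M y) z myz
        u≁y : ¬ SameComp C u y
        u≁y u~y = E₁⇒¬SameComp {G = G} (M⊆E₁ y z my≡z) (SameComp-sym u~y ◅◅ u~z)

  IsolatedRep⇒unsaturated : ∀ {M} → (∀ x y → M x ≡ just y → E₁ G C x y) →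
    ∀ u → IsolatedRep C M u → saturatesRep C M u ≡ false
  IsolatedRep⇒unsaturated {M} M⊆E₁ u (rep , isolated) = begin
    saturatesRep C M u                       ≡⟨ saturatesRep≡ M u on-u ⟩
    incident M u ∨ incident M (mate u)       ≡⟨ cong₂ _∨_ (¬incident u ε) (¬incident (mate u) u~mate) ⟩
    false                                    ∎
    where
    open ≡-Reasoning
    on-u : onTwoCycle u ≡ true
    on-u = twoCycleRep⇒onTwoCycle u rep
    ¬incident : ∀ z → SameComp C u z → incident M z ≡ false
    ¬incident = isolated⇒¬incident M⊆E₁ isolated
    u~mate : SameComp C u (mate u)
    u~mate = inj₁ (proj₁ (onTwoCycle⁻ u on-u)) ◅ ε

  isolatedCount≤unsaturatedCount : ∀ {M} → (∀ x y → M x ≡ just y → E₁ G C x y) →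
    ∀ {i} → HasCard (IsolatedRep C M) i → i ≤ unsaturatedCount C M
  isolatedCount≤unsaturatedCount {M} M⊆E₁ {i} (xs , xs-unique , xs-iff , length≡i) = begin
    i                     ≡⟨ length≡i ⟨
    length xs             ≤⟨ Unique⇒length≤∑χ _ xs xs-unique isolated⇒unsaturated ⟩
    unsaturatedCount C M  ∎
    where
    open ≤-Reasoning
    isolated⇒unsaturated : ∀ x → x ∈ xs → (twoCycleRep C x ∧ not (saturatesRep C M x)) ≡ true
    isolated⇒unsaturated x x∈xs with Equivalence.from (xs-iff x) x∈xs
    ... | isolated@(rep , _) rewrite rep | IsolatedRep⇒unsaturated M⊆E₁ x isolated = refl

-- The exchange argument

module Exchange {n} {G : Digraph n} {C : Succ n} (C-pcc : IsPCC (Edge G) C)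
                {k} (Q : KPathPartition G k) where
  open TwoCycles G C C-pcc

  Q-unique : Unique (concat (paths Q))
  Q-unique = Unique-resp-↭ (setoid (Fin n)) (↭⇒↭ₛ (↭-sym (partition Q))) (allFin⁺ n)

  next : Succ n
  next = pathsSucc (paths Q)

  next-edge : ∀ x y → next x ≡ just y → Edge G x y
  next-edge x y = pathsSucc-Linked (paths Q) (isPath Q)

  next-injective : InjSucc next
  next-injective = pathsSucc-injective (paths Q) Q-unique

  Linked-next : List (Fin n) → Set
  Linked-next = Linked (λ x y → next x ≡ just y)

  Q-Linked-next : ∀ {p} → p ∈ paths Q → Linked-next p
  Q-Linked-next {p} p∈ = Linked-by next p (Unique-concat⁻ Q-unique p∈) (pathSucc⊆pathsSucc (paths Q) Q-unique p∈)

  pathEdges≤∑edgeCount-next : pathEdges Q ≤ ∑ (edgeCount next)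
  pathEdges≤∑edgeCount-next = begin
    pathEdges Q                                  ≤⟨ sum-map-mono-≤ (All.tabulate (Linked-by⇒length∸1≤ next ∘ Q-Linked-next)) ⟩
    sum (map (sum ∘ map (edgeCount next)) (paths Q)) ≡⟨ ∑≡sum-over-partition (edgeCount next) (paths Q) (partition Q) ⟨
    ∑ (edgeCount next)                           ∎
    where open ≤-Reasoning

  -- S is Q restricted to G₁: for an edge of G at a 2-cycle, lying in E₁ only means not joining a vertex to its mate
  inE₁ : Fin n → Fin n → Bool
  inE₁ x y = (onTwoCycle x ∨ onTwoCycle y) ∧ (not ⌊ y ≟ mate x ⌋ ∧ not ⌊ x ≟ mate y ⌋)

  S : Succ n
  S x with next x
  ... | nothing = nothing
  ... | just y  = if inE₁ x y then just y else nothing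

  S⁻ : ∀ x y → S x ≡ just y → next x ≡ just y × inE₁ x y ≡ true
  S⁻ x y e with next x
  ... | just z with inE₁ x z in ok
  ...   | true  with refl ← e = refl , ok
  S⁻ x y () | just z | false

  S⁺ : ∀ x y → next x ≡ just y → inE₁ x y ≡ true → S x ≡ just y
  S⁺ x y e ok rewrite e | ok = refl

  inE₁⁻ : ∀ x y → inE₁ x y ≡ true →
    (onTwoCycle x ≡ true ⊎ onTwoCycle y ≡ true) × y ≢ mate x × x ≢ mate y
  inE₁⁻ x y ok with onTwoCycle x ∨ onTwoCycle y in on | y ≟ mate x | x ≟ mate y
  ... | true | no y≢ | no x≢ = ∨-≡-true on , y≢ , x≢

  inE₁⁺ : ∀ x y → onTwoCycle x ∨ onTwoCycle y ≡ true → y ≢ mate x → x ≢ mate y → inE₁ x y ≡ true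
  inE₁⁺ x y on y≢ x≢ with y ≟ mate x | x ≟ mate y
  ... | yes y≡ | _      = ⊥-elim (y≢ y≡)
  ... | no _   | yes x≡ = ⊥-elim (x≢ x≡)
  ... | no _   | no _   rewrite on = refl

  S-IsPCC : IsPCC (E₁ G C) S
  S-IsPCC = S-injective , S-edge
    where
    S-injective : InjSucc S
    S-injective u v w su sv = next-injective u v w (proj₁ (S⁻ u w su)) (proj₁ (S⁻ v w sv))
    S-edge : ∀ x y → S x ≡ just y → E₁ G C x y
    S-edge x y sxy with S⁻ x y sxy
    ... | nxy , ok with inE₁⁻ x y ok
    ... | on , y≢mate , x≢mate = xy , ¬Cxy , x≁y , onTwo
      where
      xy : Edge G x y
      xy = next-edge x y nxy
      x≢y : x ≢ y
      x≢y refl with () ← trans (sym (noLoop G x)) xy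
      ¬Cxy : C x ≢ just y
      ¬Cxy cxy = [ (λ on-x → y≢mate (just-injective (trans (sym cxy) (proj₁ (onTwoCycle⁻ x on-x)))))
                 , (λ on-y → x≢mate (C-injective x (mate y) y cxy (proj₂ (onTwoCycle⁻ y on-y)))) ]′ on
      x≁y : ¬ SameComp C x y
      x≁y x~y = [ (λ on-x → [ x≢y ∘ sym , y≢mate ]′ (SameComp-twoCycle x on-x x~y))
                , (λ on-y → [ x≢y , x≢mate ]′ (SameComp-twoCycle y on-y (SameComp-sym x~y))) ]′ on
      onTwo : InTwoCycle C x ⊎ InTwoCycle C y
      onTwo = Data.Sum.map (λ on-x → mate x , onTwoCycle⁻ x on-x) (λ on-y → mate y , onTwoCycle⁻ y on-y) on

  unsaturated : Fin n → Bool
  unsaturated x = onTwoCycle x ∧ not (incident S x ∨ incident S (mate x))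

  Unsaturated : Fin n → Set
  Unsaturated x = unsaturated x ≡ true

  unsaturated⇒onTwoCycle : ∀ {x} → Unsaturated x → onTwoCycle x ≡ true
  unsaturated⇒onTwoCycle ux = ∧-conicalˡ _ _ ux

  unsaturated⇒¬incident : ∀ {x} → Unsaturated x → incident S x ≢ true
  unsaturated⇒¬incident {x} ux inc
    with () ← trans (sym ux) (trans (cong (λ b → onTwoCycle x ∧ not (b ∨ incident S (mate x))) inc) (∧-zeroʳ _))

  unsaturated-mate : ∀ x → unsaturated (mate x) ≡ unsaturated x
  unsaturated-mate x with onTwoCycle x in on
  ... | true rewrite onTwoCycle-mate x | on | mate-involutive x =
    cong not (∨-comm (incident S (mate x)) (incident S x))
  ... | false = trans (cong unsaturated (mate-off x on)) (cong (_∧ not (incident S x ∨ incident S (mate x))) on)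

  next-from-unsaturated : ∀ {x y} → Unsaturated x → next x ≡ just y → y ≡ mate x
  next-from-unsaturated {x} {y} ux nxy with y ≟ mate x
  ... | yes y≡mate = y≡mate
  ... | no y≢mate  = ⊥-elim (unsaturated⇒¬incident ux (incident-out S (S⁺ x y nxy in-E₁)))
    where
    in-E₁ : inE₁ x y ≡ true
    in-E₁ = inE₁⁺ x y (cong (_∨ onTwoCycle y) (unsaturated⇒onTwoCycle ux)) y≢mate (y≢mate ∘ mate≡⇒≡mate)

  next-into-unsaturated : ∀ {x y} → Unsaturated x → next y ≡ just x → y ≡ mate x
  next-into-unsaturated {x} {y} ux nyx with y ≟ mate x
  ... | yes y≡mate = y≡mate
  ... | no y≢mate  = ⊥-elim (unsaturated⇒¬incident ux (incident-in S (S⁺ y x nyx in-E₁)))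
    where
    on : onTwoCycle y ∨ onTwoCycle x ≡ true
    on = trans (cong (onTwoCycle y ∨_) (unsaturated⇒onTwoCycle ux)) (∨-zeroʳ _)
    in-E₁ : inE₁ y x ≡ true
    in-E₁ = inE₁⁺ y x on (y≢mate ∘ mate≡⇒≡mate) y≢mate

  unsaturated-next : ∀ {x y} → next x ≡ just y → Unsaturated x → Unsaturated y
  unsaturated-next {x} nxy ux = trans (cong unsaturated (next-from-unsaturated ux nxy)) (trans (unsaturated-mate x) ux)

  unsaturated-prev : ∀ {x y} → next x ≡ just y → Unsaturated y → Unsaturated x
  unsaturated-prev {y = y} nxy uy = trans (cong unsaturated (next-into-unsaturated uy nxy)) (trans (unsaturated-mate y) uy)

  swap : Succ n
  swap x = if unsaturated x then C x else next x

  swap-IsPCC : IsPCC (Edge G) swap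
  swap-IsPCC = swap-injective , swap-edge
    where
    mixed : ∀ a b t → Unsaturated a → C a ≡ just t → next b ≡ just t → a ≡ b
    mixed a b t ua cat nbt = sym (begin
      b               ≡⟨ next-into-unsaturated ut nbt ⟩
      mate t          ≡⟨ cong mate t≡mate ⟩
      mate (mate a)   ≡⟨ mate-involutive a ⟩
      a               ∎)
      where
      open ≡-Reasoning
      t≡mate : t ≡ mate a
      t≡mate = just-injective (trans (sym cat) (proj₁ (onTwoCycle⁻ a (unsaturated⇒onTwoCycle ua))))
      ut : Unsaturated t
      ut = trans (cong unsaturated t≡mate) (trans (unsaturated-mate a) ua)
    swap-injective : InjSucc swap
    swap-injective a b t sa sb with unsaturated a in ua | unsaturated b in ub
    ... | true  | true  = C-injective a b t sa sb
    ... | true  | false = mixed a b t ua sa sb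
    ... | false | true  = sym (mixed b a t ub sb sa)
    ... | false | false = next-injective a b t sa sb
    swap-edge : ∀ a b → swap a ≡ just b → Edge G a b
    swap-edge a b e with unsaturated a
    ... | true  = proj₂ C-pcc a b e
    ... | false = next-edge a b e

  exits : Fin n → Bool
  exits x = unsaturated x ∧ is-just (next x)

  edgeCount-swap : ∀ x → edgeCount swap x + χ (exits x) ≡ edgeCount next x + χ (unsaturated x)
  edgeCount-swap x with unsaturated x in ux
  ... | true rewrite proj₁ (onTwoCycle⁻ x (unsaturated⇒onTwoCycle ux)) = +-comm 1 (edgeCount next x)
  ... | false = refl

  -- Q, having no 2-cycle, uses at most one of the two edges of an unsaturated 2-cycle
  exits-pair≤ : ∀ x → χ (exits x) + χ (exits (mate x)) ≤ χ (unsaturated x)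
  exits-pair≤ x rewrite unsaturated-mate x with unsaturated x in ux
  ... | false = z≤n
  ... | true = at-most-one (next x) refl (next (mate x)) refl
    where
    at-most-one : ∀ a → next x ≡ a → ∀ b → next (mate x) ≡ b → χ (is-just a) + χ (is-just b) ≤ 1
    at-most-one nothing  _  nothing  _   = z≤n
    at-most-one nothing  _  (just _) _   = ≤-refl
    at-most-one (just _) _  nothing  _   = ≤-refl
    at-most-one (just y) nx (just z) nmx = ⊥-elim (pathsSucc-no-2-cycle (paths Q) Q-unique x→mate mate→x)
      where
      x→mate : next x ≡ just (mate x)
      x→mate = trans nx (cong just (next-from-unsaturated ux nx))
      mate→x : next (mate x) ≡ just x
      mate→x = trans nmx (cong just (trans (next-from-unsaturated (trans (unsaturated-mate x) ux) nmx)
                                           (mate-involutive x)))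

  χ-unsaturated≡ : ∀ x → χ (unsaturated x) ≡
    χ (twoCycleRep C x ∧ unsaturated x) + χ (twoCycleRep C (mate x) ∧ unsaturated (mate x))
  χ-unsaturated≡ x rewrite unsaturated-mate x with unsaturated x in ux
  ... | false rewrite ∧-zeroʳ (twoCycleRep C x) | ∧-zeroʳ (twoCycleRep C (mate x)) = refl
  ... | true rewrite ∧-identityʳ (twoCycleRep C x) | ∧-identityʳ (twoCycleRep C (mate x)) =
    sym (χ-rep+χ-rep-mate x (unsaturated⇒onTwoCycle ux))

  rep∧unsaturated≡ : ∀ u → (twoCycleRep C u ∧ unsaturated u) ≡ (twoCycleRep C u ∧ not (saturatesRep C S u))
  rep∧unsaturated≡ u with twoCycleRep C u in rep
  ... | false = refl
  ... | true rewrite saturatesRep≡ S u (twoCycleRep⇒onTwoCycle u rep) | twoCycleRep⇒onTwoCycle u rep = refl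

  ∑unsaturated≡ : ∑ (χ ∘ unsaturated) ≡ unsaturatedCount C S + unsaturatedCount C S
  ∑unsaturated≡ = begin
    ∑ (χ ∘ unsaturated)                     ≡⟨ sum-cong-≗ χ-unsaturated≡ ⟩
    ∑ (λ x → f x + f (mate x))              ≡⟨ ∑-distrib-+ f (f ∘ mate) ⟩
    ∑ f + ∑ (f ∘ mate)                      ≡⟨ cong (∑ f +_) (∑-involution mate mate-involutive f) ⟩
    ∑ f + ∑ f                               ≡⟨ cong₂ _+_ f≡ f≡ ⟩
    unsaturatedCount C S + unsaturatedCount C S ∎
    where
    open ≡-Reasoning
    f : Fin n → ℕ
    f x = χ (twoCycleRep C x ∧ unsaturated x)
    f≡ : ∑ f ≡ unsaturatedCount C S
    f≡ = sum-cong-≗ (cong χ ∘ rep∧unsaturated≡)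

  ∑exits≤ : ∑ (χ ∘ exits) ≤ unsaturatedCount C S
  ∑exits≤ = m+m≤n+n⇒m≤n (begin
    ∑ (χ ∘ exits) + ∑ (χ ∘ exits)                ≡⟨ cong (∑ (χ ∘ exits) +_) (∑-involution mate mate-involutive (χ ∘ exits)) ⟨
    ∑ (χ ∘ exits) + ∑ (χ ∘ exits ∘ mate)         ≡⟨ ∑-distrib-+ (χ ∘ exits) (χ ∘ exits ∘ mate) ⟨
    ∑ (λ x → χ (exits x) + χ (exits (mate x)))   ≤⟨ ∑-mono-≤ exits-pair≤ ⟩
    ∑ (χ ∘ unsaturated)                          ≡⟨ ∑unsaturated≡ ⟩
    unsaturatedCount C S + unsaturatedCount C S  ∎)
    where
    open ≤-Reasoning
    m+m≤n+n⇒m≤n : ∀ {m n} → m + m ≤ n + n → m ≤ n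
    m+m≤n+n⇒m≤n {m} {n} h = *-cancelˡ-≤ 2 (subst₂ _≤_ (double m) (double n) h)
      where
      double : ∀ x → x + x ≡ 2 * x
      double x = cong (x +_) (sym (+-identityʳ x))

  exchange : ∑ (edgeCount next) + unsaturatedCount C S ≤ numEdges swap
  exchange = +-cancelʳ-≤ B (N + a) (numEdges swap) (begin
    N + a + B                          ≤⟨ +-monoʳ-≤ (N + a) ∑exits≤ ⟩
    N + a + a                          ≡⟨ +-assoc N a a ⟩
    N + (a + a)                        ≡⟨ cong (N +_) ∑unsaturated≡ ⟨
    N + ∑ (χ ∘ unsaturated)            ≡⟨ ∑-distrib-+ (edgeCount next) (χ ∘ unsaturated) ⟨
    ∑ (λ x → edgeCount next x + χ (unsaturated x)) ≡⟨ sum-cong-≗ edgeCount-swap ⟨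
    ∑ (λ x → edgeCount swap x + χ (exits x))       ≡⟨ ∑-distrib-+ (edgeCount swap) (χ ∘ exits) ⟩
    ∑ (edgeCount swap) + B             ≡⟨ cong (_+ B) (numEdges≡∑edgeCount swap) ⟨
    numEdges swap + B                  ∎)
    where
    open ≤-Reasoning
    N a B : ℕ
    N = ∑ (edgeCount next)
    a = unsaturatedCount C S
    B = ∑ (χ ∘ exits)

  all-unsaturated-from : ∀ {x q} → Linked-next (x ∷ q) → Unsaturated x → All Unsaturated (x ∷ q)
  all-unsaturated-from [-]            ux = ux ∷ []
  all-unsaturated-from (nxy ∷ linked) ux = ux ∷ all-unsaturated-from linked (unsaturated-next nxy ux)

  all-unsaturated : ∀ {p} → Linked-next p → Any Unsaturated p → All Unsaturated p
  all-unsaturated linked           (here ux)  = all-unsaturated-from linked ux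
  all-unsaturated (nxy ∷ linked) (there uy) with all-unsaturated linked uy
  ... | uy′ ∷ rest = unsaturated-prev nxy uy′ ∷ uy′ ∷ rest

  unsaturated-path-length≤2 : ∀ {p} → Unique p → Linked-next p → All Unsaturated p → length p ≤ 2
  unsaturated-path-length≤2 {[]}            _ _ _ = z≤n
  unsaturated-path-length≤2 {_ ∷ []}        _ _ _ = s≤s z≤n
  unsaturated-path-length≤2 {_ ∷ _ ∷ []}    _ _ _ = s≤s (s≤s z≤n)
  unsaturated-path-length≤2 {a ∷ b ∷ c ∷ _} (a∉ ∷ _) (nab ∷ nbc ∷ _) (ua ∷ ub ∷ _) =
    ⊥-elim (All.lookup a∉ (there (here refl)) (sym c≡a))
    where
    c≡a : c ≡ a
    c≡a = begin
      c             ≡⟨ next-from-unsaturated ub nbc ⟩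
      mate b        ≡⟨ cong mate (next-from-unsaturated ua nab) ⟩
      mate (mate a) ≡⟨ mate-involutive a ⟩
      a             ∎
      where open ≡-Reasoning

  unsaturatedIn : List (Fin n) → ℕ
  unsaturatedIn p = sum (map (χ ∘ unsaturated) p)

  unsaturatedIn≤length : ∀ p → unsaturatedIn p ≤ length p
  unsaturatedIn≤length []      = z≤n
  unsaturatedIn≤length (x ∷ p) with unsaturated x
  ... | true  = s≤s (unsaturatedIn≤length p)
  ... | false = m≤n⇒m≤1+n (unsaturatedIn≤length p)

  unsaturatedIn-Any : ∀ p → unsaturatedIn p ≢ 0 → Any Unsaturated p
  unsaturatedIn-Any []      u≢0 = ⊥-elim (u≢0 refl)
  unsaturatedIn-Any (x ∷ p) u≢0 with unsaturated x in ux
  ... | true  = here ux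
  ... | false = there (unsaturatedIn-Any p u≢0)

  -- a path avoiding unsaturated 2-cycles is short by k; one meeting such a 2-cycle lies inside it
  path-bound : ∀ m {p} → p ∈ paths Q → k ≤ 2 + m →
    2 * (length p ∸ 1) + m * unsaturatedIn p ≤ 2 * suc m
  path-bound m {p} p∈ k≤ with unsaturatedIn p ≟ℕ 0
  ... | yes u≡0 rewrite u≡0 | *-zeroʳ m | +-identityʳ (2 * (length p ∸ 1)) =
    *-monoʳ-≤ 2 (∸-monoˡ-≤ 1 (≤-trans (All.lookup (bounded Q) p∈) k≤))
  ... | no u≢0 = short p (All.lookup (nonEmpty Q) p∈)
      (unsaturated-path-length≤2 (Unique-concat⁻ Q-unique p∈) linked (all-unsaturated linked (unsaturatedIn-Any p u≢0)))
      (unsaturatedIn≤length p)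
    where
    linked : Linked-next p
    linked = Q-Linked-next p∈
    short : ∀ p → p ≢ [] → length p ≤ 2 → unsaturatedIn p ≤ length p →
      2 * (length p ∸ 1) + m * unsaturatedIn p ≤ 2 * suc m
    short []          p≢[] _ _ = ⊥-elim (p≢[] refl)
    short (x ∷ [])     _ _ u≤1 = begin
      m * unsaturatedIn (x ∷ [])  ≤⟨ *-monoʳ-≤ m u≤1 ⟩
      m * 1                ≡⟨ *-identityʳ m ⟩
      m                    ≤⟨ m≤m+n m (m + 0) ⟩
      2 * m                ≤⟨ m≤n+m (2 * m) 2 ⟩
      2 + 2 * m            ≡⟨ *-suc 2 m ⟨
      2 * suc m            ∎
      where open ≤-Reasoning
    short (x ∷ y ∷ []) _ _ u≤2 = begin
      2 + m * unsaturatedIn (x ∷ y ∷ [])  ≤⟨ +-monoʳ-≤ 2 (*-monoʳ-≤ m u≤2) ⟩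
      2 + m * 2                ≡⟨ cong (2 +_) (*-comm m 2) ⟩
      2 + 2 * m                ≡⟨ *-suc 2 m ⟨
      2 * suc m                ∎
      where open ≤-Reasoning
    short (_ ∷ _ ∷ _ ∷ _) _ (s≤s (s≤s ())) _

  pathEdges-bound : ∀ m → k ≤ 2 + m → pathEdges Q + m * unsaturatedCount C S ≤ suc m * size Q
  pathEdges-bound m k≤ = *-cancelˡ-≤ 2 (begin
    2 * (E + m * a)                      ≡⟨ rearrange E m a ⟩
    2 * E + m * (a + a)                  ≡⟨ cong (λ t → 2 * E + m * t) (trans ∑unsaturated≡′ ∑unsaturated≡) ⟨
    2 * E + m * sum (map unsaturatedIn (paths Q))
                                         ≤⟨ sum-map-linear-≤ (λ p → length p ∸ 1) unsaturatedIn 2 m (2 * suc m)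
                                              (All.tabulate (λ p∈ → path-bound m p∈ k≤)) ⟩
    size Q * (2 * suc m)                 ≡⟨ *-comm (size Q) (2 * suc m) ⟩
    2 * suc m * size Q                   ≡⟨ *-assoc 2 (suc m) (size Q) ⟩
    2 * (suc m * size Q)                 ∎)
    where
    open ≤-Reasoning
    open +-*-Solver
    E a : ℕ
    E = pathEdges Q
    a = unsaturatedCount C S
    ∑unsaturated≡′ : sum (map unsaturatedIn (paths Q)) ≡ ∑ (χ ∘ unsaturated)
    ∑unsaturated≡′ = sym (∑≡sum-over-partition (χ ∘ unsaturated) (paths Q) (partition Q))
    rearrange : ∀ E m a → 2 * (E + m * a) ≡ 2 * E + m * (a + a)
    rearrange = solve 3 (λ E m a → con 2 :* (E :+ m :* a) := con 2 :* E :+ m :* (a :+ a)) refl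

order≡pathEdges+size : ∀ {n} {G : Digraph n} {k} (Q : KPathPartition G k) → n ≡ pathEdges Q + size Q
order≡pathEdges+size {n} Q = begin
  n                                ≡⟨ length-tabulate id ⟨
  length (allFin n)                ≡⟨ ↭-length (partition Q) ⟨
  length (concat (paths Q))        ≡⟨ length-concat (paths Q) ⟩
  sum (map length (paths Q))       ≡⟨ sum-map-length (paths Q) (nonEmpty Q) ⟩
  pathEdges Q + size Q             ∎
  where open ≡-Reasoning

weighted-bound : ∀ m E P a i → i ≤ a → E + m * a ≤ suc m * P →
  suc (suc m) * E + suc m * (2 * i) ≤ suc m * (E + P) + suc (suc m) * i
weighted-bound m E P a i i≤a E+ma≤ = begin
  suc (suc m) * E + suc m * (2 * i)     ≡⟨ split-lhs m E i ⟩
  X + (E + m * i)                       ≤⟨ +-monoʳ-≤ X (+-monoʳ-≤ E (*-monoʳ-≤ m i≤a)) ⟩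
  X + (E + m * a)                       ≤⟨ +-monoʳ-≤ X E+ma≤ ⟩
  X + suc m * P                         ≡⟨ split-rhs m E P i ⟩
  suc m * (E + P) + suc (suc m) * i     ∎
  where
  open ≤-Reasoning
  open +-*-Solver
  X : ℕ
  X = suc m * E + 2 * i + m * i
  split-lhs : ∀ m E i → suc (suc m) * E + suc m * (2 * i) ≡ (suc m * E + 2 * i + m * i) + (E + m * i)
  split-lhs = solve 3 (λ m E i → (con 2 :+ m) :* E :+ (con 1 :+ m) :* (con 2 :* i) :=
                                 ((con 1 :+ m) :* E :+ con 2 :* i :+ m :* i) :+ (E :+ m :* i)) refl
  split-rhs : ∀ m E P i → (suc m * E + 2 * i + m * i) + suc m * P ≡ suc m * (E + P) + suc (suc m) * i
  split-rhs = solve 4 (λ m E P i → ((con 1 :+ m) :* E :+ con 2 :* i :+ m :* i) :+ (con 1 :+ m) :* P :=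
                                   (con 1 :+ m) :* (E :+ P) :+ (con 2 :+ m) :* i) refl

lemma2 : ∀ (n : ℕ) (G : Digraph n) (k : ℕ) → 7 ≤ k →
    ∀ (C : Succ n) → IsConstructedC G C →
    ∀ (M : Succ n) → IsConstructedM G C M →
    ∀ (Q : KPathPartition G k) → MinKPathPartition G k Q →
    ∀ (i : ℕ) → HasCard (IsolatedRep C M) i →
    (pathEdges Q + i ≤ numEdges C) ×
    (k * pathEdges Q + (k ∸ 1) * (2 * i) ≤ (k ∸ 1) * n + k * i)
lemma2 n G (suc (suc m)) (s≤s (s≤s _)) C C-constructed M M-constructed Q _ i isolated-i = edges-bound , weighted
  where
  C-max : MaxPCC G C
  C-max = IsConstructedC⇒MaxPCC {G = G} C-constructed
  M-max : MaxWeightPCC G C M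
  M-max = IsConstructedM⇒MaxWeightPCC {G = G} {C} {M} M-constructed
  open Exchange (proj₁ C-max) Q
  i≤a : i ≤ unsaturatedCount C S
  i≤a = ≤-trans (isolatedCount≤unsaturatedCount {G = G} (proj₁ C-max) (proj₂ (proj₁ M-max)) isolated-i)
                (unsaturatedCount-antitone C S M (proj₂ M-max S S-IsPCC))
  edges-bound : pathEdges Q + i ≤ numEdges C
  edges-bound = ≤-trans (+-mono-≤ pathEdges≤∑edgeCount-next i≤a) (≤-trans exchange (proj₂ C-max swap swap-IsPCC))
  weighted : suc (suc m) * pathEdges Q + suc m * (2 * i) ≤ suc m * n + suc (suc m) * i
  weighted = ≤-trans (weighted-bound m (pathEdges Q) (size Q) _ i i≤a (pathEdges-bound m ≤-refl))
                     (≤-reflexive (cong (λ t → suc m * t + suc (suc m) * i) (sym (order≡pathEdges+size Q))))
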